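{- Assume the setting below. Then (1) $AX_i=kX_i+X_{i+1}$ for $0\le i\le d-1$; (2) for $0\le i\le d$, $A^iX=\sum_{j=0}^i\binom{i}{j}k^{i-j}X_j=\sum_{h=0}^d\alpha_{h,i}A_h$.
   Context: Setting: Let $d\ge 2$ and $k\ge 3$ be integers. Let numbers $c_i,a_i,b_i$ ($-1\le i\le d+1$) satisfy $c_{ -1}=c_0=0$, $c_1=1$, $c_{d+1}=0$, $b_{ -1}=0$, $b_0=k$, $b_d=b_{d+1}=0$, $a_0=0$, $k=c_i+a_i+b_i$ for all $-1\le i\le d+1$, $1=c_1\le c_2\le\cdots\le c_d\le k$ and $k=b_0\ge b_1\ge\cdots\ge b_{d-1}\ge 1$. Let $A_{ -1}=\mathbf 0, A_0,A_1,\dots,A_d,A_{d+1}=\mathbf 0$ be $n\times n$ matrices with $A_0=I$, $A_1=A$, $A\mathbf j=k\mathbf j$ (where $\mathbf j$ is the all-ones column vector), the minimal polynomial of $A$ has degree at least $d+1$, $J=A_0+A_1+\cdots+A_d$ (with $J$ the all-ones matrix), and $AA_i=b_{i-1}A_{i-1}+a_iA_i+c_{i+1}A_{i+1}$ for $0\le i\le d$. Let $\{x_{i,j}: 0\le i\le d,\,-1\le j\le d+1\}$ be numbers with $x_{i,-1}=x_{i,d+1}=0$ for $0\le i\le d$ and $x_{i+1,j}=(x_{i,j+1}-x_{i,j})b_j-(x_{i,j}-x_{i,j-1})c_j$ for $0\le i\le d-1$, $0\le j\le d$ (the values $x_{0,j}$, $0\le j\le d$, are arbitrary). Let $X_i=\sum_{j=0}^d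 x_{i,j}A_j$ for $0\le i\le d$, $X=X_0$, and $\alpha_{h,i}=\sum_{j=0}^i\binom{i}{j}k^{i-j}x_{j,h}$ for $0\le i,h\le d$.
   Formalization: The numbers $c_i,a_i,b_i$ and $x_{i,j}$ and the entries of the matrices $A_0,A_1,\dots,A_d$ are rational. -}

module Defs where

open import Data.Nat as ℕ using (ℕ; zero; suc; _∸_)
open import Data.Nat.Combinatorics using (_C_)
open import Data.Integer as ℤ using (+_)
open import Data.Rational using (ℚ; 0ℚ; 1ℚ; _+_; _*_; _/_)
open import Data.Fin as Fin using (Fin; _≟_)
open import Relation.Nullary using (yes; no)
open import Data.Unit using (⊤)
open import Relation.Binary.PropositionalEquality using (_≡_)

ℕ→ℚ : ℕ → ℚ
ℕ→ℚ m = + m / 1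

-- sum_{j=0}^{m} f j  (inclusive upper bound)
sumℚ : ℕ → (ℕ → ℚ) → ℚ
sumℚ zero    f = f 0
sumℚ (suc m) f = sumℚ m f + f (suc m)

-- value at index j-1 of a sequence, with the convention that the value at index -1 is 0
prevℚ : (ℕ → ℚ) → ℕ → ℚ
prevℚ f zero    = 0ℚ
prevℚ f (suc j) = f j

Mat : ℕ → Set
Mat n = Fin n → Fin n → ℚ

_≈ₘ_ : ∀ {n} → Mat n → Mat n → Set
M ≈ₘ N = ∀ r s → M r s ≡ N r s
infix 4 _≈ₘ_

0ₘ : ∀ {n} → Mat n
0ₘ r s = 0ℚ

Iₘ : ∀ {n} → Mat n
Iₘ r s with r ≟ s
... | yes _ = 1ℚ
... | no  _ = 0ℚ

Jₘ : ∀ {n} → Mat n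
Jₘ r s = 1ℚ

_+ₘ_ : ∀ {n} → Mat n → Mat n → Mat n
(M +ₘ N) r s = M r s + N r s
infixl 6 _+ₘ_

_·ₘ_ : ∀ {n} → ℚ → Mat n → Mat n
(q ·ₘ M) r s = q * M r s
infixl 7 _·ₘ_

sumFin : ∀ n → (Fin n → ℚ) → ℚ
sumFin zero    f = 0ℚ
sumFin (suc n) f = f Fin.zero + sumFin n (λ i → f (Fin.suc i))

_*ₘ_ : ∀ {n} → Mat n → Mat n → Mat n
_*ₘ_ {n} M N r s = sumFin n (λ t → M r t * N t s)
infixl 7 _*ₘ_

_^ₘ_ : ∀ {n} → Mat n → ℕ → Mat n
M ^ₘ zero  = Iₘ
M ^ₘ suc i = M *ₘ (M ^ₘ i)

sumₘ : ∀ {n} → ℕ → (ℕ → Mat n) → Mat n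
sumₘ zero    F = F 0
sumₘ (suc m) F = sumₘ m F +ₘ F (suc m)

-- matrix at index j-1, with A_{-1} = 0
prevₘ : ∀ {n} → (ℕ → Mat n) → ℕ → Mat n
prevₘ F zero    = 0ₘ
prevₘ F (suc j) = F j

-- row sums: M j = k j
RowSums : ∀ {n} → Mat n → ℚ → Set
RowSums {n} M q = ∀ r → sumFin n (λ s → M r s) ≡ q

-- "the minimal polynomial of M has degree at least m":
-- no nonzero polynomial p of degree < m satisfies p(M) = 0
MinPolyDegAtLeast : ∀ {n} → Mat n → ℕ → Set
MinPolyDegAtLeast M zero    = ⊤
MinPolyDegAtLeast M (suc m) =
  (p : ℕ → ℚ) → sumₘ m (λ i → p i ·ₘ (M ^ₘ i)) ≈ₘ 0ₘ → ∀ i → i ℕ.≤ m → p i ≡ 0ℚ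

Xmat : ∀ {n} → ℕ → (ℕ → Mat n) → (ℕ → ℕ → ℚ) → ℕ → Mat n
Xmat d As x i = sumₘ d (λ j → x i j ·ₘ As j)

alpha : ℕ → (ℕ → ℕ → ℚ) → ℕ → ℕ → ℚ
alpha k x h i = sumℚ i (λ j → ℕ→ℚ ((i C j) ℕ.* (k ℕ.^ (i ∸ j))) * x j h)

{-# OPTIONS --safe #-}
module Submission where

-- Expanding A X_i = Σ_j x_{i,j} A A_j by the three-term recurrence for A A_j and shifting
-- indices gives Σ_j (b_j x_{i,j+1} + a_j x_{i,j} + c_j x_{i,j-1}) A_j, the boundary terms
-- vanishing because b_{-1} = x_{i,-1} = b_d = c_{d+1} = 0. As k = a_j + b_j + c_j, the recurrence defining
-- x_{i+1,j} turns this coefficient into k x_{i,j} + x_{i+1,j}. So A acts on X_0, X_1, … as k plus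
-- the shift X_j ↦ X_{j+1}, and Pascal's rule gives A^i X = Σ_j C(i,j) k^{i-j} X_j by induction on i;
-- expanding each X_j in the A_h and exchanging the two sums yields the coefficients α_{h,i}.

open import Defs
open import Data.Nat using (ℕ; suc; _∸_) renaming (_≤_ to _≤ℕ_; _<_ to _<ℕ_; _*_ to _*ℕ_; _^_ to _^ℕ_)
open import Data.Nat.Combinatorics using (_C_)
open import Data.Rational using (ℚ; 0ℚ; 1ℚ; _+_; _-_; _*_; _≤_)
open import Data.Product using (_×_)
open import Relation.Binary.PropositionalEquality using (_≡_)

open import Algebra.Bundles using (Ring)
open import Data.Fin as Fin using (Fin; zero; suc)
open import Data.Fin.Properties using (suc-injective)
import Data.Integer as ℤ
import Data.Integer.Properties as ℤᴾ
open import Data.Nat as ℕ using (zero; z≤n; s≤s; _≤?_)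
import Data.Nat.Properties as ℕᴾ
open import Data.Nat.Combinatorics using (nCk+nC[k+1]≡[n+1]C[k+1]; k>n⇒nCk≡0)
open import Data.Nat.Coprimality using (1-coprimeTo)
import Data.Nat.Coprimality as Coprime
open import Data.Product using (_,_)
open import Data.Rational using (mkℚ; _/_)
import Data.Rational.Properties as ℚᴾ
open import Data.Rational.Solver using (module +-*-Solver)
open import Function using (_∘_)
open import Relation.Nullary using (yes; no)
open import Relation.Nullary.Negation using (contradiction)
open import Relation.Binary.PropositionalEquality
  using (refl; sym; trans; cong; cong₂; _≢_; module ≡-Reasoning)

open import Algebra.Properties.Semiring.Sum (Ring.semiring ℚᴾ.+-*-ring)
  using (sum; sum-cong-≗; sum-replicate-zero; ∑-distrib-+; ∑-comm; *-distribˡ-sum; *-distribʳ-sum)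
open import Algebra.Properties.CommutativeSemigroup ℕᴾ.*-commutativeSemigroup using (x∙yz≈y∙xz)
open +-*-Solver using (solve; _:=_; _:+_; _:*_; _:-_)

ℕ→ℚ≡mkℚ : ∀ m → ℕ→ℚ m ≡ mkℚ (ℤ.+ m) 0 (Coprime.sym (1-coprimeTo m))
ℕ→ℚ≡mkℚ m = ℚᴾ.normalize-coprime (Coprime.sym (1-coprimeTo m))

ℕ→ℚ-homo-+ : ∀ m n → ℕ→ℚ (m ℕ.+ n) ≡ ℕ→ℚ m + ℕ→ℚ n
ℕ→ℚ-homo-+ m n rewrite ℕ→ℚ≡mkℚ m | ℕ→ℚ≡mkℚ n =
  cong (_/ 1) (trans (ℤᴾ.pos-+ m n)
                     (sym (cong₂ ℤ._+_ (ℤᴾ.*-identityʳ (ℤ.+ m)) (ℤᴾ.*-identityʳ (ℤ.+ n)))))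

ℕ→ℚ-homo-* : ∀ m n → ℕ→ℚ (m ℕ.* n) ≡ ℕ→ℚ m * ℕ→ℚ n
ℕ→ℚ-homo-* m n rewrite ℕ→ℚ≡mkℚ m | ℕ→ℚ≡mkℚ n = cong (_/ 1) (ℤᴾ.pos-* m n)

sumℚ-cong : ∀ m {f g : ℕ → ℚ} → (∀ j → j ≤ℕ m → f j ≡ g j) → sumℚ m f ≡ sumℚ m g
sumℚ-cong zero    f≗g = f≗g 0 z≤n
sumℚ-cong (suc m) f≗g =
  cong₂ _+_ (sumℚ-cong m (λ j j≤m → f≗g j (ℕᴾ.m≤n⇒m≤1+n j≤m))) (f≗g (suc m) ℕᴾ.≤-refl)

sumℚ-distrib-+ : ∀ m (f g : ℕ → ℚ) → sumℚ m (λ j → f j + g j) ≡ sumℚ m f + sumℚ m g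
sumℚ-distrib-+ zero    f g = refl
sumℚ-distrib-+ (suc m) f g =
  trans (cong (_+ (f (suc m) + g (suc m))) (sumℚ-distrib-+ m f g))
        (solve 4 (λ p q u v → (p :+ q) :+ (u :+ v) := (p :+ u) :+ (q :+ v)) refl
               (sumℚ m f) (sumℚ m g) (f (suc m)) (g (suc m)))

*-distribˡ-sumℚ : ∀ m q (f : ℕ → ℚ) → q * sumℚ m f ≡ sumℚ m (λ j → q * f j)
*-distribˡ-sumℚ zero    q f = refl
*-distribˡ-sumℚ (suc m) q f =
  trans (ℚᴾ.*-distribˡ-+ q (sumℚ m f) (f (suc m))) (cong (_+ q * f (suc m)) (*-distribˡ-sumℚ m q f))

*-distribʳ-sumℚ : ∀ m q (f : ℕ → ℚ) → sumℚ m f * q ≡ sumℚ m (λ j → f j * q)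
*-distribʳ-sumℚ zero    q f = refl
*-distribʳ-sumℚ (suc m) q f =
  trans (ℚᴾ.*-distribʳ-+ q (sumℚ m f) (f (suc m))) (cong (_+ f (suc m) * q) (*-distribʳ-sumℚ m q f))

sumℚ-comm : ∀ m p (f : ℕ → ℕ → ℚ) →
  sumℚ m (λ j → sumℚ p (f j)) ≡ sumℚ p (λ h → sumℚ m (λ j → f j h))
sumℚ-comm zero    p f = refl
sumℚ-comm (suc m) p f =
  trans (cong (_+ sumℚ p (f (suc m))) (sumℚ-comm m p f))
        (sym (sumℚ-distrib-+ p (λ h → sumℚ m (λ j → f j h)) (f (suc m))))

sumℚ-suc : ∀ m (f : ℕ → ℚ) → sumℚ (suc m) f ≡ f 0 + sumℚ m (f ∘ suc)
sumℚ-suc zero    f = refl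
sumℚ-suc (suc m) f =
  trans (cong (_+ f (suc (suc m))) (sumℚ-suc m f)) (ℚᴾ.+-assoc (f 0) (sumℚ m (f ∘ suc)) (f (suc (suc m))))

sumℚ-shift : ∀ m (f : ℕ → ℚ) → f 0 ≡ 0ℚ → f (suc m) ≡ 0ℚ → sumℚ m (f ∘ suc) ≡ sumℚ m f
sumℚ-shift m f f0≡0 fm+1≡0 = begin
  sumℚ m (f ∘ suc)               ≡⟨ sym (ℚᴾ.+-identityˡ _) ⟩
  0ℚ + sumℚ m (f ∘ suc)          ≡⟨ cong (_+ sumℚ m (f ∘ suc)) (sym f0≡0) ⟩
  f 0 + sumℚ m (f ∘ suc)         ≡⟨ sym (sumℚ-suc m f) ⟩
  sumℚ m f + f (suc m)           ≡⟨ cong (sumℚ m f +_) fm+1≡0 ⟩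
  sumℚ m f + 0ℚ                  ≡⟨ ℚᴾ.+-identityʳ _ ⟩
  sumℚ m f                       ∎
  where open ≡-Reasoning

sumFin≡sum : ∀ n (f : Fin n → ℚ) → sumFin n f ≡ sum f
sumFin≡sum zero    f = refl
sumFin≡sum (suc n) f = cong (f zero +_) (sumFin≡sum n (f ∘ suc))

sum-supported-at : ∀ {n} (f : Fin n → ℚ) r → (∀ t → t ≢ r → f t ≡ 0ℚ) → sum f ≡ f r
sum-supported-at {suc n} f zero f≡0 = begin
  f zero + sum (f ∘ suc)      ≡⟨ cong (f zero +_) (sum-cong-≗ (λ t → f≡0 (suc t) λ ())) ⟩
  f zero + sum {n} (λ _ → 0ℚ) ≡⟨ cong (f zero +_) (sum-replicate-zero n) ⟩
  f zero + 0ℚ                 ≡⟨ ℚᴾ.+-identityʳ (f zero) ⟩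
  f zero                      ∎
  where open ≡-Reasoning
sum-supported-at {suc n} f (suc r) f≡0 = begin
  f zero + sum (f ∘ suc) ≡⟨ cong₂ _+_ (f≡0 zero λ ()) (sum-supported-at (f ∘ suc) r f∘suc≡0) ⟩
  0ℚ + f (suc r)         ≡⟨ ℚᴾ.+-identityˡ (f (suc r)) ⟩
  f (suc r)              ∎
  where
  open ≡-Reasoning
  f∘suc≡0 : ∀ t → t ≢ r → f (suc t) ≡ 0ℚ
  f∘suc≡0 t t≢r = f≡0 (suc t) (t≢r ∘ suc-injective)

sumₘ-entry : ∀ {n} m (F : ℕ → Mat n) r s → sumₘ m F r s ≡ sumℚ m (λ j → F j r s)
sumₘ-entry zero    F r s = refl
sumₘ-entry (suc m) F r s = cong (_+ F (suc m) r s) (sumₘ-entry m F r s)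

sumₘ-cong : ∀ {n} m {F G : ℕ → Mat n} → (∀ j → j ≤ℕ m → F j ≈ₘ G j) → sumₘ m F ≈ₘ sumₘ m G
sumₘ-cong m F≈G r s =
  trans (sumₘ-entry m _ r s) (trans (sumℚ-cong m (λ j j≤m → F≈G j j≤m r s)) (sym (sumₘ-entry m _ r s)))

*ₘ-entry : ∀ {n} (M N : Mat n) r s → (M *ₘ N) r s ≡ sum (λ t → M r t * N t s)
*ₘ-entry {n} M N r s = sumFin≡sum n (λ t → M r t * N t s)

*ₘ-congˡ : ∀ {n} (M : Mat n) {N N′ : Mat n} → N ≈ₘ N′ → M *ₘ N ≈ₘ M *ₘ N′
*ₘ-congˡ M {N} {N′} N≈N′ r s = begin
  (M *ₘ N) r s              ≡⟨ *ₘ-entry M N r s ⟩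
  sum (λ t → M r t * N t s)  ≡⟨ sum-cong-≗ (λ t → cong (M r t *_) (N≈N′ t s)) ⟩
  sum (λ t → M r t * N′ t s) ≡⟨ sym (*ₘ-entry M N′ r s) ⟩
  (M *ₘ N′) r s             ∎
  where open ≡-Reasoning

Iₘ-diag : ∀ {n} (r : Fin n) → Iₘ r r ≡ 1ℚ
Iₘ-diag r with r Fin.≟ r
... | yes _   = refl
... | no  r≢r = contradiction refl r≢r

Iₘ-offdiag : ∀ {n} (r t : Fin n) → t ≢ r → Iₘ r t ≡ 0ℚ
Iₘ-offdiag r t t≢r with r Fin.≟ t
... | yes r≡t = contradiction (sym r≡t) t≢r
... | no _    = refl

*ₘ-identityˡ : ∀ {n} (M : Mat n) → Iₘ *ₘ M ≈ₘ M
*ₘ-identityˡ M r s = begin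
  (Iₘ *ₘ M) r s              ≡⟨ *ₘ-entry Iₘ M r s ⟩
  sum (λ t → Iₘ r t * M t s) ≡⟨ sum-supported-at _ r off-diagonal ⟩
  Iₘ r r * M r s             ≡⟨ cong (_* M r s) (Iₘ-diag r) ⟩
  1ℚ * M r s                 ≡⟨ ℚᴾ.*-identityˡ (M r s) ⟩
  M r s                      ∎
  where
  open ≡-Reasoning
  off-diagonal : ∀ t → t ≢ r → Iₘ r t * M t s ≡ 0ℚ
  off-diagonal t t≢r = trans (cong (_* M t s) (Iₘ-offdiag r t t≢r)) (ℚᴾ.*-zeroˡ (M t s))

*ₘ-assoc : ∀ {n} (M N P : Mat n) → (M *ₘ N) *ₘ P ≈ₘ M *ₘ (N *ₘ P)
*ₘ-assoc M N P r s = begin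
  ((M *ₘ N) *ₘ P) r s
    ≡⟨ *ₘ-entry (M *ₘ N) P r s ⟩
  sum (λ t → (M *ₘ N) r t * P t s)
    ≡⟨ sum-cong-≗ (λ t → trans (cong (_* P t s) (*ₘ-entry M N r t))
                               (*-distribʳ-sum (P t s) (λ u → M r u * N u t))) ⟩
  sum (λ t → sum (λ u → M r u * N u t * P t s))
    ≡⟨ ∑-comm (λ t u → M r u * N u t * P t s) ⟩
  sum (λ u → sum (λ t → M r u * N u t * P t s))
    ≡⟨ sum-cong-≗ (λ u → trans (sum-cong-≗ (λ t → ℚᴾ.*-assoc (M r u) (N u t) (P t s)))
                               (sym (*-distribˡ-sum (M r u) (λ t → N u t * P t s)))) ⟩
  sum (λ u → M r u * sum (λ t → N u t * P t s))
    ≡⟨ sym (trans (*ₘ-entry M (N *ₘ P) r s) (sum-cong-≗ (λ u → cong (M r u *_) (*ₘ-entry N P u s)))) ⟩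
  (M *ₘ (N *ₘ P)) r s
    ∎
  where open ≡-Reasoning

*ₘ-distribˡ-+ₘ : ∀ {n} (M N P : Mat n) → M *ₘ (N +ₘ P) ≈ₘ M *ₘ N +ₘ M *ₘ P
*ₘ-distribˡ-+ₘ M N P r s = begin
  (M *ₘ (N +ₘ P)) r s
    ≡⟨ *ₘ-entry M (N +ₘ P) r s ⟩
  sum (λ t → M r t * (N t s + P t s))
    ≡⟨ sum-cong-≗ (λ t → ℚᴾ.*-distribˡ-+ (M r t) (N t s) (P t s)) ⟩
  sum (λ t → M r t * N t s + M r t * P t s)
    ≡⟨ ∑-distrib-+ (λ t → M r t * N t s) (λ t → M r t * P t s) ⟩
  sum (λ t → M r t * N t s) + sum (λ t → M r t * P t s)
    ≡⟨ sym (cong₂ _+_ (*ₘ-entry M N r s) (*ₘ-entry M P r s)) ⟩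
  (M *ₘ N +ₘ M *ₘ P) r s
    ∎
  where open ≡-Reasoning

*ₘ-·ₘ-comm : ∀ {n} (M : Mat n) q (N : Mat n) → M *ₘ (q ·ₘ N) ≈ₘ q ·ₘ (M *ₘ N)
*ₘ-·ₘ-comm M q N r s = begin
  (M *ₘ (q ·ₘ N)) r s
    ≡⟨ *ₘ-entry M (q ·ₘ N) r s ⟩
  sum (λ t → M r t * (q * N t s))
    ≡⟨ sum-cong-≗ (λ t → solve 3 (λ x y z → x :* (y :* z) := y :* (x :* z)) refl (M r t) q (N t s)) ⟩
  sum (λ t → q * (M r t * N t s))
    ≡⟨ sym (*-distribˡ-sum q (λ t → M r t * N t s)) ⟩
  q * sum (λ t → M r t * N t s)
    ≡⟨ cong (q *_) (sym (*ₘ-entry M N r s)) ⟩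
  (q ·ₘ (M *ₘ N)) r s
    ∎
  where open ≡-Reasoning

*ₘ-distribˡ-lincomb : ∀ {n} (M : Mat n) m (q : ℕ → ℚ) (N : ℕ → Mat n) →
  M *ₘ sumₘ m (λ j → q j ·ₘ N j) ≈ₘ sumₘ m (λ j → q j ·ₘ (M *ₘ N j))
*ₘ-distribˡ-lincomb M zero    q N = *ₘ-·ₘ-comm M (q 0) (N 0)
*ₘ-distribˡ-lincomb M (suc m) q N r s =
  trans (*ₘ-distribˡ-+ₘ M (sumₘ m (λ j → q j ·ₘ N j)) (q (suc m) ·ₘ N (suc m)) r s)
        (cong₂ _+_ (*ₘ-distribˡ-lincomb M m q N r s) (*ₘ-·ₘ-comm M (q (suc m)) (N (suc m)) r s))

lincomb-scale-+ : ∀ {n} m q (p p′ : ℕ → ℚ) (N : ℕ → Mat n) →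
  sumₘ m (λ j → (q * p j + p′ j) ·ₘ N j)
    ≈ₘ q ·ₘ sumₘ m (λ j → p j ·ₘ N j) +ₘ sumₘ m (λ j → p′ j ·ₘ N j)
lincomb-scale-+ m q p p′ N r s = begin
  sumₘ m (λ j → (q * p j + p′ j) ·ₘ N j) r s
    ≡⟨ sumₘ-entry m _ r s ⟩
  sumℚ m (λ j → (q * p j + p′ j) * N j r s)
    ≡⟨ sumℚ-cong m (λ j _ → solve 4 (λ q x y z → (q :* x :+ y) :* z := q :* (x :* z) :+ y :* z) refl
                                     q (p j) (p′ j) (N j r s)) ⟩
  sumℚ m (λ j → q * (p j * N j r s) + p′ j * N j r s)
    ≡⟨ sumℚ-distrib-+ m _ _ ⟩
  sumℚ m (λ j → q * (p j * N j r s)) + sumℚ m (λ j → p′ j * N j r s)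
    ≡⟨ cong (_+ sumℚ m (λ j → p′ j * N j r s)) (sym (*-distribˡ-sumℚ m q _)) ⟩
  q * sumℚ m (λ j → p j * N j r s) + sumℚ m (λ j → p′ j * N j r s)
    ≡⟨ sym (cong₂ (λ u v → q * u + v) (sumₘ-entry m _ r s) (sumₘ-entry m _ r s)) ⟩
  (q ·ₘ sumₘ m (λ j → p j ·ₘ N j) +ₘ sumₘ m (λ j → p′ j ·ₘ N j)) r s
    ∎
  where open ≡-Reasoning

lincomb-lincomb : ∀ {n} m d (p : ℕ → ℚ) (q : ℕ → ℕ → ℚ) (N : ℕ → Mat n) →
  sumₘ m (λ j → p j ·ₘ sumₘ d (λ h → q j h ·ₘ N h))
    ≈ₘ sumₘ d (λ h → sumℚ m (λ j → p j * q j h) ·ₘ N h)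
lincomb-lincomb m d p q N r s = begin
  sumₘ m (λ j → p j ·ₘ sumₘ d (λ h → q j h ·ₘ N h)) r s
    ≡⟨ sumₘ-entry m _ r s ⟩
  sumℚ m (λ j → p j * sumₘ d (λ h → q j h ·ₘ N h) r s)
    ≡⟨ sumℚ-cong m (λ j _ → trans (cong (p j *_) (sumₘ-entry d _ r s)) (*-distribˡ-sumℚ d (p j) _)) ⟩
  sumℚ m (λ j → sumℚ d (λ h → p j * (q j h * N h r s)))
    ≡⟨ sumℚ-comm m d _ ⟩
  sumℚ d (λ h → sumℚ m (λ j → p j * (q j h * N h r s)))
    ≡⟨ sumℚ-cong d (λ h _ → sym (trans (*-distribʳ-sumℚ m (N h r s) _)
                                        (sumℚ-cong m (λ j _ → ℚᴾ.*-assoc (p j) (q j h) (N h r s))))) ⟩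
  sumℚ d (λ h → sumℚ m (λ j → p j * q j h) * N h r s)
    ≡⟨ sym (sumₘ-entry d _ r s) ⟩
  sumₘ d (λ h → sumℚ m (λ j → p j * q j h) ·ₘ N h) r s
    ∎
  where open ≡-Reasoning

p≡0⇒p*q*r≡0 : ∀ {p} q r → p ≡ 0ℚ → p * q * r ≡ 0ℚ
p≡0⇒p*q*r≡0 q r refl = trans (cong (_* r) (ℚᴾ.*-zeroˡ q)) (ℚᴾ.*-zeroˡ r)

*ₘ-tridiagonal-lincomb : ∀ {n} d (A : Mat n) (As : ℕ → Mat n) (a b c : ℕ → ℚ) →
  b d ≡ 0ℚ → c (suc d) ≡ 0ℚ →
  (∀ j → j ≤ℕ d → A *ₘ As j ≈ₘ prevℚ b j ·ₘ prevₘ As j +ₘ a j ·ₘ As j +ₘ c (suc j) ·ₘ As (suc j)) →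
  (y : ℕ → ℚ) →
  A *ₘ sumₘ d (λ j → y j ·ₘ As j)
    ≈ₘ sumₘ d (λ j → (b j * y (suc j) + a j * y j + c j * prevℚ y j) ·ₘ As j)
*ₘ-tridiagonal-lincomb d A As a b c bd≡0 cd+1≡0 AAs≈ y r s = begin
  (A *ₘ sumₘ d (λ j → y j ·ₘ As j)) r s
    ≡⟨ *ₘ-distribˡ-lincomb A d y As r s ⟩
  sumₘ d (λ j → y j ·ₘ (A *ₘ As j)) r s
    ≡⟨ sumₘ-entry d _ r s ⟩
  sumℚ d (λ j → y j * (A *ₘ As j) r s)
    ≡⟨ sumℚ-cong d (λ j j≤d → trans (cong (y j *_) (AAs≈ j j≤d r s)) (expand j)) ⟩
  sumℚ d (λ j → lower j + middle j + upper (suc j))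
    ≡⟨ sumℚ-distrib-+₃ lower middle (upper ∘ suc) ⟩
  sumℚ d lower + sumℚ d middle + sumℚ d (upper ∘ suc)
    ≡⟨ cong₂ (λ u v → u + sumℚ d middle + v)
             (sym (sumℚ-shift d lower (p≡0⇒p*q*r≡0 (y 0) 0ℚ refl) (p≡0⇒p*q*r≡0 _ _ bd≡0)))
             (sumℚ-shift d upper upper-0 (p≡0⇒p*q*r≡0 _ _ cd+1≡0)) ⟩
  sumℚ d (lower ∘ suc) + sumℚ d middle + sumℚ d upper
    ≡⟨ sym (sumℚ-distrib-+₃ (lower ∘ suc) middle upper) ⟩
  sumℚ d (λ j → lower (suc j) + middle j + upper j)
    ≡⟨ sumℚ-cong d (λ j _ → collect j) ⟩
  sumℚ d (λ j → (b j * y (suc j) + a j * y j + c j * prevℚ y j) * As j r s)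
    ≡⟨ sym (sumₘ-entry d _ r s) ⟩
  sumₘ d (λ j → (b j * y (suc j) + a j * y j + c j * prevℚ y j) ·ₘ As j) r s
    ∎
  where
  open ≡-Reasoning
  lower middle upper : ℕ → ℚ
  lower  j = prevℚ b j * y j * prevₘ As j r s
  middle j = a j * y j * As j r s
  upper  j = c j * prevℚ y j * As j r s

  sumℚ-distrib-+₃ : ∀ f g h → sumℚ d (λ j → f j + g j + h j) ≡ sumℚ d f + sumℚ d g + sumℚ d h
  sumℚ-distrib-+₃ f g h =
    trans (sumℚ-distrib-+ d (λ j → f j + g j) h) (cong (_+ sumℚ d h) (sumℚ-distrib-+ d f g))

  expand : ∀ j →
    y j * (prevℚ b j * prevₘ As j r s + a j * As j r s + c (suc j) * As (suc j) r s)
      ≡ lower j + middle j + upper (suc j)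
  expand j =
    solve 7 (λ t β α γ L M U → t :* (β :* L :+ α :* M :+ γ :* U)
                             := β :* t :* L :+ α :* t :* M :+ γ :* t :* U)
          refl (y j) (prevℚ b j) (a j) (c (suc j)) (prevₘ As j r s) (As j r s) (As (suc j) r s)

  collect : ∀ j →
    lower (suc j) + middle j + upper j ≡ (b j * y (suc j) + a j * y j + c j * prevℚ y j) * As j r s
  collect j =
    solve 7 (λ β t₊ α t γ t₋ M → β :* t₊ :* M :+ α :* t :* M :+ γ :* t₋ :* M
                               := (β :* t₊ :+ α :* t :+ γ :* t₋) :* M)
          refl (b j) (y (suc j)) (a j) (y j) (c j) (prevℚ y j) (As j r s)

  upper-0 : c 0 * 0ℚ * As 0 r s ≡ 0ℚ
  upper-0 = trans (cong (_* As 0 r s) (ℚᴾ.*-zeroʳ (c 0))) (ℚᴾ.*-zeroˡ (As 0 r s))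

coefficient-recurrence : ∀ k a b c u v w → k ≡ c + a + b →
  b * w + a * v + c * u ≡ k * v + ((w - v) * b - (v - u) * c)
coefficient-recurrence k a b c u v w refl =
  solve 6 (λ a b c u v w → b :* w :+ a :* v :+ c :* u := (c :+ a :+ b) :* v :+ ((w :- v) :* b :- (v :- u) :* c))
        refl a b c u v w

Xmat-recurrence : ∀ {n} d k (A : Mat n) (As : ℕ → Mat n) (a b c : ℕ → ℚ) (x : ℕ → ℕ → ℚ) →
  (∀ j → j ≤ℕ d → ℕ→ℚ k ≡ c j + a j + b j) → b d ≡ 0ℚ → c (suc d) ≡ 0ℚ →
  (∀ j → j ≤ℕ d → A *ₘ As j ≈ₘ prevℚ b j ·ₘ prevₘ As j +ₘ a j ·ₘ As j +ₘ c (suc j) ·ₘ As (suc j)) →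
  (∀ i j → i <ℕ d → j ≤ℕ d →
    x (suc i) j ≡ (x i (suc j) - x i j) * b j - (x i j - prevℚ (x i) j) * c j) →
  ∀ i → i <ℕ d → A *ₘ Xmat d As x i ≈ₘ ℕ→ℚ k ·ₘ Xmat d As x i +ₘ Xmat d As x (suc i)
Xmat-recurrence d k A As a b c x k≡c+a+b bd≡0 cd+1≡0 AAs≈ x-rec i i<d r s = begin
  (A *ₘ Xmat d As x i) r s
    ≡⟨ *ₘ-tridiagonal-lincomb d A As a b c bd≡0 cd+1≡0 AAs≈ (x i) r s ⟩
  sumₘ d (λ j → (b j * x i (suc j) + a j * x i j + c j * prevℚ (x i) j) ·ₘ As j) r s
    ≡⟨ sumₘ-cong d (λ j j≤d r s → cong (_* As j r s) (coefficient j j≤d)) r s ⟩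
  sumₘ d (λ j → (ℕ→ℚ k * x i j + x (suc i) j) ·ₘ As j) r s
    ≡⟨ lincomb-scale-+ d (ℕ→ℚ k) (x i) (x (suc i)) As r s ⟩
  (ℕ→ℚ k ·ₘ Xmat d As x i +ₘ Xmat d As x (suc i)) r s
    ∎
  where
  open ≡-Reasoning
  coefficient : ∀ j → j ≤ℕ d →
    b j * x i (suc j) + a j * x i j + c j * prevℚ (x i) j ≡ ℕ→ℚ k * x i j + x (suc i) j
  coefficient j j≤d = trans (coefficient-recurrence _ (a j) (b j) (c j) _ _ _ (k≡c+a+b j j≤d))
                            (cong (ℕ→ℚ k * x i j +_) (sym (x-rec i j i<d j≤d)))

binomialWeight : ℕ → ℕ → ℕ → ℕ
binomialWeight k m j = (m C j) *ℕ (k ^ℕ (m ∸ j))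

binomialWeight-beyond : ∀ k m → binomialWeight k m (suc m) ≡ 0
binomialWeight-beyond k m rewrite k>n⇒nCk≡0 {m} {suc m} ℕᴾ.≤-refl = refl

binomialWeight-suc-zero : ∀ k m → binomialWeight k (suc m) 0 ≡ k *ℕ binomialWeight k m 0
binomialWeight-suc-zero k m =
  trans (ℕᴾ.*-identityˡ (k ^ℕ suc m)) (cong (k *ℕ_) (sym (ℕᴾ.*-identityˡ (k ^ℕ m))))

mC[1+j]*k^[m∸j] : ∀ k m j → (m C suc j) *ℕ (k ^ℕ (m ∸ j)) ≡ k *ℕ binomialWeight k m (suc j)
-- If m ≤ j the binomial coefficient vanishes; otherwise m ∸ j = 1 + (m ∸ suc j).
mC[1+j]*k^[m∸j] k m j with m ≤? j
... | yes m≤j rewrite k>n⇒nCk≡0 (s≤s m≤j) = sym (ℕᴾ.*-zeroʳ k)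
... | no  m≰j rewrite ℕᴾ.+-∸-assoc 1 (ℕᴾ.≰⇒> m≰j) =
  x∙yz≈y∙xz (m C suc j) k (k ^ℕ (m ∸ suc j))

binomialWeight-suc-suc : ∀ k m j →
  binomialWeight k (suc m) (suc j) ≡ binomialWeight k m j ℕ.+ k *ℕ binomialWeight k m (suc j)
binomialWeight-suc-suc k m j = begin
  (suc m C suc j) *ℕ k ^ℕ (m ∸ j)
    ≡⟨ cong (_*ℕ k ^ℕ (m ∸ j)) (sym (nCk+nC[k+1]≡[n+1]C[k+1] m j)) ⟩
  (m C j ℕ.+ m C suc j) *ℕ k ^ℕ (m ∸ j)
    ≡⟨ ℕᴾ.*-distribʳ-+ (k ^ℕ (m ∸ j)) (m C j) (m C suc j) ⟩
  binomialWeight k m j ℕ.+ (m C suc j) *ℕ k ^ℕ (m ∸ j)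
    ≡⟨ cong (binomialWeight k m j ℕ.+_) (mC[1+j]*k^[m∸j] k m j) ⟩
  binomialWeight k m j ℕ.+ k *ℕ binomialWeight k m (suc j)
    ∎
  where open ≡-Reasoning

binomial-step : ∀ k m (v : ℕ → ℚ) →
  sumℚ m (λ j → ℕ→ℚ (binomialWeight k m j) * (ℕ→ℚ k * v j + v (suc j)))
    ≡ sumℚ (suc m) (λ j → ℕ→ℚ (binomialWeight k (suc m) j) * v j)
binomial-step k m v = begin
  sumℚ m (λ j → w m j * (K * v j + v (suc j)))
    ≡⟨ sumℚ-cong m (λ j _ → solve 4 (λ x y z z′ → x :* (y :* z :+ z′) := y :* x :* z :+ x :* z′) refl
                                     (w m j) K (v j) (v (suc j))) ⟩
  sumℚ m (λ j → G j + B j)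
    ≡⟨ sumℚ-distrib-+ m G B ⟩
  sumℚ m G + sumℚ m B
    ≡⟨ cong (_+ sumℚ m B) (sym (trans (cong (sumℚ m G +_) G-beyond) (ℚᴾ.+-identityʳ (sumℚ m G)))) ⟩
  sumℚ (suc m) G + sumℚ m B
    ≡⟨ cong (_+ sumℚ m B) (sumℚ-suc m G) ⟩
  G 0 + sumℚ m (G ∘ suc) + sumℚ m B
    ≡⟨ ℚᴾ.+-assoc (G 0) (sumℚ m (G ∘ suc)) (sumℚ m B) ⟩
  G 0 + (sumℚ m (G ∘ suc) + sumℚ m B)
    ≡⟨ cong (G 0 +_) (sym (sumℚ-distrib-+ m (G ∘ suc) B)) ⟩
  G 0 + sumℚ m (λ j → G (suc j) + B j)
    ≡⟨ cong₂ _+_ (cong (_* v 0) (sym w-suc-zero)) (sumℚ-cong m (λ j _ → G[1+j]+B[j] j)) ⟩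
  w (suc m) 0 * v 0 + sumℚ m (λ j → w (suc m) (suc j) * v (suc j))
    ≡⟨ sym (sumℚ-suc m (λ j → w (suc m) j * v j)) ⟩
  sumℚ (suc m) (λ j → w (suc m) j * v j)
    ∎
  where
  open ≡-Reasoning
  K = ℕ→ℚ k
  w : ℕ → ℕ → ℚ
  w i j = ℕ→ℚ (binomialWeight k i j)
  G B : ℕ → ℚ
  G j = K * w m j * v j
  B j = w m j * v (suc j)

  G-beyond : G (suc m) ≡ 0ℚ
  G-beyond = begin
    K * w m (suc m) * v (suc m) ≡⟨ cong (λ z → K * ℕ→ℚ z * v (suc m)) (binomialWeight-beyond k m) ⟩
    K * 0ℚ * v (suc m)          ≡⟨ cong (_* v (suc m)) (ℚᴾ.*-zeroʳ K) ⟩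
    0ℚ * v (suc m)              ≡⟨ ℚᴾ.*-zeroˡ (v (suc m)) ⟩
    0ℚ                          ∎

  w-suc-zero : w (suc m) 0 ≡ K * w m 0
  w-suc-zero = trans (cong ℕ→ℚ (binomialWeight-suc-zero k m)) (ℕ→ℚ-homo-* k _)

  w-suc-suc : ∀ j → w (suc m) (suc j) ≡ w m j + K * w m (suc j)
  w-suc-suc j = begin
    w (suc m) (suc j)
      ≡⟨ cong ℕ→ℚ (binomialWeight-suc-suc k m j) ⟩
    ℕ→ℚ (binomialWeight k m j ℕ.+ k *ℕ binomialWeight k m (suc j))
      ≡⟨ ℕ→ℚ-homo-+ (binomialWeight k m j) _ ⟩
    w m j + ℕ→ℚ (k *ℕ binomialWeight k m (suc j))
      ≡⟨ cong (w m j +_) (ℕ→ℚ-homo-* k _) ⟩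
    w m j + K * w m (suc j)
      ∎

  G[1+j]+B[j] : ∀ j → G (suc j) + B j ≡ w (suc m) (suc j) * v (suc j)
  G[1+j]+B[j] j = trans
    (solve 4 (λ x y′ y z → x :* y′ :* z :+ y :* z := (y :+ x :* y′) :* z)
             refl K (w m (suc j)) (w m j) (v (suc j)))
    (cong (_* v (suc j)) (sym (w-suc-suc j)))

^ₘ-*ₘ-binomial : ∀ {n} k d (A : Mat n) (X : ℕ → Mat n) →
  (∀ i → i <ℕ d → A *ₘ X i ≈ₘ ℕ→ℚ k ·ₘ X i +ₘ X (suc i)) →
  ∀ i → i ≤ℕ d → (A ^ₘ i) *ₘ X 0 ≈ₘ sumₘ i (λ j → ℕ→ℚ (binomialWeight k i j) ·ₘ X j)
^ₘ-*ₘ-binomial k d A X AX≈kX+X′ zero _ r s =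
  trans (*ₘ-identityˡ (X 0) r s) (sym (ℚᴾ.*-identityˡ (X 0 r s)))
^ₘ-*ₘ-binomial k d A X AX≈kX+X′ (suc i) i<d r s = begin
  ((A *ₘ (A ^ₘ i)) *ₘ X 0) r s
    ≡⟨ *ₘ-assoc A (A ^ₘ i) (X 0) r s ⟩
  (A *ₘ ((A ^ₘ i) *ₘ X 0)) r s
    ≡⟨ *ₘ-congˡ A (^ₘ-*ₘ-binomial k d A X AX≈kX+X′ i (ℕᴾ.<⇒≤ i<d)) r s ⟩
  (A *ₘ sumₘ i (λ j → w i j ·ₘ X j)) r s
    ≡⟨ *ₘ-distribˡ-lincomb A i (w i) X r s ⟩
  sumₘ i (λ j → w i j ·ₘ (A *ₘ X j)) r s
    ≡⟨ sumₘ-entry i _ r s ⟩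
  sumℚ i (λ j → w i j * (A *ₘ X j) r s)
    ≡⟨ sumℚ-cong i (λ j j≤i → cong (w i j *_) (AX≈kX+X′ j (ℕᴾ.≤-<-trans j≤i i<d) r s)) ⟩
  sumℚ i (λ j → w i j * (ℕ→ℚ k * X j r s + X (suc j) r s))
    ≡⟨ binomial-step k i (λ j → X j r s) ⟩
  sumℚ (suc i) (λ j → w (suc i) j * X j r s)
    ≡⟨ sym (sumₘ-entry (suc i) _ r s) ⟩
  sumₘ (suc i) (λ j → w (suc i) j ·ₘ X j) r s
    ∎
  where
  open ≡-Reasoning
  w : ℕ → ℕ → ℚ
  w i j = ℕ→ℚ (binomialWeight k i j)

lemma2 : (d k : ℕ) → 2 ≤ℕ d → 3 ≤ℕ k →
    (c a b : ℕ → ℚ) →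
    c 0 ≡ 0ℚ → c 1 ≡ 1ℚ → c (suc d) ≡ 0ℚ →
    b 0 ≡ ℕ→ℚ k → b d ≡ 0ℚ → b (suc d) ≡ 0ℚ → a 0 ≡ 0ℚ →
    (∀ i → i ≤ℕ suc d → ℕ→ℚ k ≡ c i + a i + b i) →
    (∀ i → 1 ≤ℕ i → i <ℕ d → c i ≤ c (suc i)) → c d ≤ ℕ→ℚ k →
    (∀ i → suc i ≤ℕ d ∸ 1 → b (suc i) ≤ b i) → 1ℚ ≤ b (d ∸ 1) →
    (n : ℕ) (As : ℕ → Mat n) →
    As 0 ≈ₘ Iₘ → As (suc d) ≈ₘ 0ₘ →
    RowSums (As 1) (ℕ→ℚ k) →
    MinPolyDegAtLeast (As 1) (suc d) →
    sumₘ d As ≈ₘ Jₘ →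
    (∀ i → i ≤ℕ d →
      As 1 *ₘ As i ≈ₘ prevℚ b i ·ₘ prevₘ As i +ₘ a i ·ₘ As i +ₘ c (suc i) ·ₘ As (suc i)) →
    (x : ℕ → ℕ → ℚ) →
    (∀ i → i ≤ℕ d → x i (suc d) ≡ 0ℚ) →
    (∀ i j → i <ℕ d → j ≤ℕ d →
      x (suc i) j ≡ (x i (suc j) - x i j) * b j - (x i j - prevℚ (x i) j) * c j) →
    (∀ i → i <ℕ d →
      As 1 *ₘ Xmat d As x i ≈ₘ ℕ→ℚ k ·ₘ Xmat d As x i +ₘ Xmat d As x (suc i))
    ×
    (∀ i → i ≤ℕ d →
      ((As 1 ^ₘ i) *ₘ Xmat d As x 0
         ≈ₘ sumₘ i (λ j → ℕ→ℚ ((i C j) *ℕ (k ^ℕ (i ∸ j))) ·ₘ Xmat d As x j))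
      ×
      ((As 1 ^ₘ i) *ₘ Xmat d As x 0
         ≈ₘ sumₘ d (λ h → alpha k x h i ·ₘ As h)))
lemma2 d k _ _ c a b _ _ cd+1≡0 _ bd≡0 _ _ k≡c+a+b _ _ _ _ _ As _ _ _ _ _ AAs≈ x _ x-rec =
  AX≈kX+X′ , λ i i≤d → power i i≤d , alpha-form i i≤d
  where
  X = Xmat d As x
  AX≈kX+X′ : ∀ i → i <ℕ d → As 1 *ₘ X i ≈ₘ ℕ→ℚ k ·ₘ X i +ₘ X (suc i)
  AX≈kX+X′ = Xmat-recurrence d k (As 1) As a b c x (λ j j≤d → k≡c+a+b j (ℕᴾ.m≤n⇒m≤1+n j≤d))
                             bd≡0 cd+1≡0 AAs≈ x-rec
  power : ∀ i → i ≤ℕ d → (As 1 ^ₘ i) *ₘ X 0 ≈ₘ sumₘ i (λ j → ℕ→ℚ (binomialWeight k i j) ·ₘ X j)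
  power = ^ₘ-*ₘ-binomial k d (As 1) X AX≈kX+X′
  alpha-form : ∀ i → i ≤ℕ d → (As 1 ^ₘ i) *ₘ X 0 ≈ₘ sumₘ d (λ h → alpha k x h i ·ₘ As h)
  alpha-form i i≤d r s =
    trans (power i i≤d r s) (lincomb-lincomb i d (λ j → ℕ→ℚ (binomialWeight k i j)) x As r s)
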